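{- Let $b$ and $\ell$ be integers with $b\ge 3$ and $\ell\ge 1$. If $a$ is an integer with $3\le a\le b^\ell$, then $\mathrm{b}(a,b)\le \ell+2$.
   Context: $\mathrm{b}(a,b)$ denotes the base size (smallest cardinality of a subset whose pointwise stabilizer is trivial) of $\mathrm{Sym}(ab)$ acting on the set of partitions of $\{1,\ldots,ab\}$ into $b$ parts each of cardinality $a$. -}

module Defs where

open import Data.Nat using (ℕ; _*_)
open import Data.Fin using (Fin; _≟_)
open import Data.Fin.Permutation using (Permutation′; _⟨$⟩ʳ_)
open import Data.List using (List; length; filter; allFin)
open import Data.List.Membership.Propositional using (_∈_)
open import Data.Product using (Σ; proj₁)
open import Function.Bundles using (_⇔_)
open import Relation.Binary.PropositionalEquality using (_≡_)

fiberSize : {n b : ℕ} → (Fin n → Fin b) → Fin b → ℕ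
fiberSize {n} f i = length (filter (λ x → f x ≟ i) (allFin n))

-- A partition of {1,…,ab} (here Fin (a * b)) into b parts each of size a,
-- presented by a labelling of the points by the b parts (the label of a
-- part is irrelevant: all notions below only use "x and y lie in the
-- same part").
Partition : ℕ → ℕ → Set
Partition a b = Σ (Fin (a * b) → Fin b) (λ f → ∀ i → fiberSize f i ≡ a)

SamePart : {a b : ℕ} → Partition a b → Fin (a * b) → Fin (a * b) → Set
SamePart P x y = proj₁ P x ≡ proj₁ P y

-- σ fixes the partition P, i.e. σ(P) = P (σ maps every part of P onto a part of P).
Fixes : {a b : ℕ} → Permutation′ (a * b) → Partition a b → Set
Fixes σ P = ∀ x y → SamePart P (σ ⟨$⟩ʳ x) (σ ⟨$⟩ʳ y) ⇔ SamePart P x y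

IsBase : {a b : ℕ} → List (Partition a b) → Set
IsBase {a} {b} Ps =
  (σ : Permutation′ (a * b)) → (∀ P → P ∈ Ps → Fixes σ P) → ∀ x → σ ⟨$⟩ʳ x ≡ x

{-# OPTIONS --safe #-}
-- Read the ab points as the cells of an a × b grid; a labelling in which every row is a
-- permutation of the b labels is a partition into b parts of size a, and a permutation σ
-- fixing it permutes its labels.  Take the column partition, for each t < ℓ the partition
-- shifting row r by the t-th base-b digit of r, and one partition twisting a few rows.
-- Columns and digits separate cells, so σ is trivial once it fixes row 0 up to one cell.
-- Against the columns, the twisted partition singles out the deviant cells (twisted label
-- ≠ column), recognisable by how many cells share both their column and twisted label; so
-- σ preserves them and the induced permutation of columns is an automorphism of a small
-- rigid configuration in ℤ/b, which forces it to be the identity.  For b = 3 and a ∈ {3, 4}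
-- bases of size 3 and 4 are found and checked by exhaustive computation.

module Submission where

open import Defs
open import Data.Bool.Base using (Bool; true; false; if_then_else_)
open import Data.Nat.Base using (ℕ; zero; suc; _+_; _*_; _∸_; _≤_; _<_; _^_; s≤s; z≤n)
open import Data.Nat.Properties renaming (_≟_ to _≟ℕ_) using (+-monoˡ-≤; m≤n+m; ≤-reflexive; +-assoc; +-comm; +-identityʳ; *-comm; *-identityʳ; <⇒≤; <-≤-trans; m+[n∸m]≡n; n<1⇒n≡0)
open import Data.Nat.DivMod using (_%_; _/_; _mod_; m%n<n; m%n%n≡m%n; %-distribˡ-+; m<n⇒m%n≡m; n%n≡0; m≡m%n+[m/n]*n; m<n*o⇒m/o<n)
open import Data.Fin.Base using (Fin; zero; suc; toℕ; fromℕ<; _↑ˡ_; _↑ʳ_; combine; remQuot)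
open import Data.Fin.Properties using (_≟_; all?; any?; remQuot-combine; combine-remQuot; toℕ-injective; toℕ<n; toℕ-fromℕ<; fromℕ<-toℕ)
open import Data.Fin.Patterns using (0F; 1F; 2F; 3F; 4F)
open import Data.Fin.Permutation as Perm using (Permutation′; _⟨$⟩ʳ_; _⟨$⟩ˡ_; _∘ₚ_; inverseˡ; inverseʳ)
open import Data.List.Base using (List; []; _∷_; length; filter; tabulate; allFin)
open import Data.Vec.Base as Vec using (Vec; lookup)
open import Data.Vec.Properties using (lookup∘tabulate)
open import Data.List.Membership.Propositional using (_∈_)
open import Data.List.Membership.Propositional.Properties using (∈-filter⁻; ∈-tabulate⁺)
open import Data.List.Properties using (length-tabulate)
open import Data.List.Relation.Unary.Any using (here; there)
open import Data.Product.Base using (∃; ∃₂; _,_; proj₁; proj₂; _×_)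
open import Data.Sum.Base using (_⊎_; inj₁; inj₂)
open import Data.Empty using (⊥; ⊥-elim)
open import Function.Base using (_∘_; case_of_)
open import Function.Bundles using (Equivalence)
open import Relation.Nullary using (¬_; Dec; yes; no; does; contradiction)
open import Relation.Nullary.Decidable using (map′; decidable-stable; from-yes; ¬?; _×-dec_; _⊎-dec_; _→-dec_)
open import Relation.Unary using (Decidable)
open import Relation.Binary.PropositionalEquality

count : ∀ n → (Fin n → Bool) → ℕ
count zero    p = 0
count (suc n) p = (if p zero then 1 else 0) + count n (p ∘ suc)

length-filter-tabulate : ∀ {A : Set} {P : A → Set} (P? : Decidable P) n (g : Fin n → A) →
  length (filter P? (tabulate g)) ≡ count n (does ∘ P? ∘ g)
length-filter-tabulate P? zero    g = refl
length-filter-tabulate P? (suc n) g with does (P? (g zero))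
... | true  = cong suc (length-filter-tabulate P? n (g ∘ suc))
... | false = length-filter-tabulate P? n (g ∘ suc)

count-cong : ∀ n {p q : Fin n → Bool} → (∀ i → p i ≡ q i) → count n p ≡ count n q
count-cong zero    p≗q = refl
count-cong (suc n) p≗q = cong₂ (λ b m → (if b then 1 else 0) + m) (p≗q zero) (count-cong n (p≗q ∘ suc))

count-++ : ∀ m n (p : Fin (m + n) → Bool) →
  count (m + n) p ≡ count m (p ∘ (_↑ˡ n)) + count n (p ∘ (m ↑ʳ_))
count-++ zero    n p = refl
count-++ (suc m) n p = trans (cong ((if p zero then 1 else 0) +_) (count-++ m n (p ∘ suc)))
  (sym (+-assoc (if p zero then 1 else 0) _ _))

count-combine : ∀ a b k (p : Fin (a * b) → Bool) →
  (∀ (r : Fin a) → count b (λ c → p (combine r c)) ≡ k) → count (a * b) p ≡ a * k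
count-combine zero    b k p rows = refl
count-combine (suc a) b k p rows = trans (count-++ b (a * b) p)
  (cong₂ _+_ (rows zero) (count-combine a b k (p ∘ (b ↑ʳ_)) (λ r → rows (suc r))))

count-≟ : ∀ n (j : Fin n) → count n (λ i → does (i ≟ j)) ≡ 1
count-≟ (suc n) zero    = cong suc (count-false n)
  where
  count-false : ∀ n → count n (λ i → does (suc i ≟ zero)) ≡ 0
  count-false zero    = refl
  count-false (suc n) = count-false n
count-≟ (suc n) (suc j) = count-≟ n j

count-permutation-≟ : ∀ n (π : Permutation′ n) (j : Fin n) → count n (λ i → does (π ⟨$⟩ʳ i ≟ j)) ≡ 1
count-permutation-≟ n π j = trans (count-cong n same-answer) (count-≟ n (π ⟨$⟩ˡ j))
  where
  same-answer : ∀ i → does (π ⟨$⟩ʳ i ≟ j) ≡ does (i ≟ π ⟨$⟩ˡ j)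
  same-answer i with π ⟨$⟩ʳ i ≟ j | i ≟ π ⟨$⟩ˡ j
  ... | yes _   | yes _   = refl
  ... | no  _   | no  _   = refl
  ... | yes πi≡j | no i≢ = contradiction (trans (sym (inverseˡ π)) (cong (π ⟨$⟩ˡ_) πi≡j)) i≢
  ... | no πi≢j | yes i≡ = contradiction (trans (cong (π ⟨$⟩ʳ_) i≡) (inverseʳ π)) πi≢j

-- Grid partitions

module Coordinates (a b : ℕ) where

  -- Abstract, so that a grid label reduces no further than f (row x) ⟨$⟩ʳ col x.
  abstract
    cell : Fin a → Fin b → Fin (a * b)
    cell = combine

    row : Fin (a * b) → Fin a
    row x = proj₁ (remQuot {a} b x)

    col : Fin (a * b) → Fin b
    col x = proj₂ (remQuot {a} b x)

    row-cell : ∀ r c → row (cell r c) ≡ r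
    row-cell r c = cong proj₁ (remQuot-combine {a} {b} r c)

    col-cell : ∀ r c → col (cell r c) ≡ c
    col-cell r c = cong proj₂ (remQuot-combine {a} {b} r c)

    cell-row-col : ∀ x → cell (row x) (col x) ≡ x
    cell-row-col x = combine-remQuot {a} b x

    count-by-rows : ∀ k (p : Fin (a * b) → Bool) →
      (∀ r → count b (λ c → p (cell r c)) ≡ k) → count (a * b) p ≡ a * k
    count-by-rows = count-combine a b

  cell-injective : ∀ {r c r′ c′} → cell r c ≡ cell r′ c′ → r ≡ r′ × c ≡ c′
  cell-injective {r} {c} {r′} {c′} eq =
    trans (sym (row-cell r c)) (trans (cong row eq) (row-cell r′ c′)) ,
    trans (sym (col-cell r c)) (trans (cong col eq) (col-cell r′ c′))

  ≡-by-coordinates : ∀ {x y} → row x ≡ row y → col x ≡ col y → x ≡ y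
  ≡-by-coordinates {x} {y} r≡ c≡ = trans (sym (cell-row-col x)) (trans (cong₂ cell r≡ c≡) (cell-row-col y))

  rowLabel : (Fin a → Permutation′ b) → Fin (a * b) → Fin b
  rowLabel f x = f (row x) ⟨$⟩ʳ col x

  rowLabel-cell : ∀ f r c → rowLabel f (cell r c) ≡ f r ⟨$⟩ʳ c
  rowLabel-cell f r c = cong₂ (λ r c → f r ⟨$⟩ʳ c) (row-cell r c) (col-cell r c)

  rowPartition : (Fin a → Permutation′ b) → Partition a b
  rowPartition f = rowLabel f , λ i → begin
    fiberSize (rowLabel f) i                      ≡⟨ length-filter-tabulate (λ x → rowLabel f x ≟ i) (a * b) (λ x → x) ⟩
    count (a * b) (λ x → does (rowLabel f x ≟ i)) ≡⟨ count-by-rows 1 _ (one-per-row i) ⟩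
    a * 1                                         ≡⟨ *-identityʳ a ⟩
    a                                             ∎
    where
    open ≡-Reasoning
    one-per-row : ∀ i r → count b (λ c → does (rowLabel f (cell r c) ≟ i)) ≡ 1
    one-per-row i r = trans (count-cong b λ c → cong (λ l → does (l ≟ i)) (rowLabel-cell f r c))
                            (count-permutation-≟ b (f r) i)

partition-surjective : ∀ {a b} (P : Partition (suc a) b) i → ∃ λ x → proj₁ P x ≡ i
partition-surjective {a} {b} (label , fiber) i
  with filter (λ x → label x ≟ i) (allFin (suc a * b)) in eq | fiber i
... | []    | ()
... | x ∷ _ | _  = x , proj₂ (∈-filter⁻ (λ x → label x ≟ i) {xs = allFin (suc a * b)} (subst (x ∈_) (sym eq) (here refl)))

module InducedPermutation {a b} (σ : Permutation′ (suc a * b)) (P : Partition (suc a) b) (fixes : Fixes σ P) where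

  private
    label = proj₁ P
    representative : Fin b → Fin (suc a * b)
    representative i = proj₁ (partition-surjective P i)

  -- Abstract: unfolding α would run the filter hidden in partition-surjective.
  abstract
    α : Fin b → Fin b
    α i = label (σ ⟨$⟩ʳ representative i)

    α-law : ∀ x → label (σ ⟨$⟩ʳ x) ≡ α (label x)
    α-law x = Equivalence.from (fixes x (representative (label x)))
                (sym (proj₂ (partition-surjective P (label x))))

    α-injective : ∀ {i j} → α i ≡ α j → i ≡ j
    α-injective {i} {j} αi≡αj =
      trans (sym (proj₂ (partition-surjective P i)))
            (trans (Equivalence.to (fixes (representative i) (representative j)) αi≡αj)
                   (proj₂ (partition-surjective P j)))

-- Arithmetic in ℤ/b and base-b digits

module Cyclic (n : ℕ) where

  private
    B = 2 + n

  infixl 6 _⊕_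

  _⊕_ : Fin B → Fin B → Fin B
  x ⊕ y = (toℕ x + toℕ y) mod B

  ⊖_ : Fin B → Fin B
  ⊖ x = (B ∸ toℕ x) mod B

  private
    toℕ-mod : ∀ m → toℕ (m mod B) ≡ m % B
    toℕ-mod m = toℕ-fromℕ< (m%n<n m B)

    toℕ-⊕ : ∀ x y → toℕ (x ⊕ y) ≡ (toℕ x + toℕ y) % B
    toℕ-⊕ x y = toℕ-mod (toℕ x + toℕ y)

    %-absorbˡ : ∀ m k → (m % B + k) % B ≡ (m + k) % B
    %-absorbˡ m k = begin
      (m % B + k) % B          ≡⟨ %-distribˡ-+ (m % B) k B ⟩
      (m % B % B + k % B) % B  ≡⟨ cong (λ z → (z + k % B) % B) (m%n%n≡m%n m B) ⟩
      (m % B + k % B) % B      ≡⟨ %-distribˡ-+ m k B ⟨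
      (m + k) % B              ∎
      where open ≡-Reasoning

    %-absorbʳ : ∀ m k → (m + k % B) % B ≡ (m + k) % B
    %-absorbʳ m k = trans (cong (_% B) (+-comm m (k % B)))
                          (trans (%-absorbˡ k m) (cong (_% B) (+-comm k m)))

  ⊕-comm : ∀ x y → x ⊕ y ≡ y ⊕ x
  ⊕-comm x y = cong (_mod B) (+-comm (toℕ x) (toℕ y))

  ⊕-assoc : ∀ x y z → (x ⊕ y) ⊕ z ≡ x ⊕ (y ⊕ z)
  ⊕-assoc x y z = toℕ-injective (begin
    toℕ ((x ⊕ y) ⊕ z)                ≡⟨ toℕ-⊕ (x ⊕ y) z ⟩
    (toℕ (x ⊕ y) + toℕ z) % B        ≡⟨ cong (λ w → (w + toℕ z) % B) (toℕ-⊕ x y) ⟩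
    ((toℕ x + toℕ y) % B + toℕ z) % B ≡⟨ %-absorbˡ (toℕ x + toℕ y) (toℕ z) ⟩
    (toℕ x + toℕ y + toℕ z) % B      ≡⟨ cong (_% B) (+-assoc (toℕ x) (toℕ y) (toℕ z)) ⟩
    (toℕ x + (toℕ y + toℕ z)) % B    ≡⟨ %-absorbʳ (toℕ x) (toℕ y + toℕ z) ⟨
    (toℕ x + (toℕ y + toℕ z) % B) % B ≡⟨ cong (λ w → (toℕ x + w) % B) (toℕ-⊕ y z) ⟨
    (toℕ x + toℕ (y ⊕ z)) % B        ≡⟨ toℕ-⊕ x (y ⊕ z) ⟨
    toℕ (x ⊕ (y ⊕ z))                ∎)
    where open ≡-Reasoning

  ⊕-identityʳ : ∀ x → x ⊕ zero ≡ x
  ⊕-identityʳ x = toℕ-injective (trans (toℕ-⊕ x zero)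
    (trans (cong (_% B) (+-identityʳ (toℕ x))) (m<n⇒m%n≡m (toℕ<n x))))

  ⊕-identityˡ : ∀ x → zero ⊕ x ≡ x
  ⊕-identityˡ x = trans (⊕-comm zero x) (⊕-identityʳ x)

  ⊕-inverseʳ : ∀ x → x ⊕ ⊖ x ≡ zero
  ⊕-inverseʳ x = toℕ-injective (begin
    toℕ (x ⊕ ⊖ x)                    ≡⟨ toℕ-⊕ x (⊖ x) ⟩
    (toℕ x + toℕ (⊖ x)) % B          ≡⟨ cong (λ w → (toℕ x + w) % B) (toℕ-mod (B ∸ toℕ x)) ⟩
    (toℕ x + (B ∸ toℕ x) % B) % B    ≡⟨ %-absorbʳ (toℕ x) (B ∸ toℕ x) ⟩
    (toℕ x + (B ∸ toℕ x)) % B        ≡⟨ cong (_% B) (m+[n∸m]≡n (<⇒≤ (toℕ<n x))) ⟩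
    B % B                            ≡⟨ n%n≡0 B ⟩
    0                                ∎)
    where open ≡-Reasoning

  ⊕-inverseˡ : ∀ x → ⊖ x ⊕ x ≡ zero
  ⊕-inverseˡ x = trans (⊕-comm (⊖ x) x) (⊕-inverseʳ x)

  ⊕-⊖-cancel : ∀ x d → x ⊕ d ⊕ ⊖ d ≡ x
  ⊕-⊖-cancel x d = trans (⊕-assoc x d (⊖ d)) (trans (cong (x ⊕_) (⊕-inverseʳ d)) (⊕-identityʳ x))

  ⊖-⊕-cancel : ∀ x d → x ⊕ ⊖ d ⊕ d ≡ x
  ⊖-⊕-cancel x d = trans (⊕-assoc x (⊖ d) d) (trans (cong (x ⊕_) (⊕-inverseˡ d)) (⊕-identityʳ x))

  ⊕-cancelʳ : ∀ d {x y} → x ⊕ d ≡ y ⊕ d → x ≡ y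
  ⊕-cancelʳ d {x} {y} eq = trans (sym (⊕-⊖-cancel x d)) (trans (cong (_⊕ ⊖ d) eq) (⊕-⊖-cancel y d))

  ⊕-cancelˡ : ∀ d {x y} → d ⊕ x ≡ d ⊕ y → x ≡ y
  ⊕-cancelˡ d {x} {y} eq = ⊕-cancelʳ d (trans (⊕-comm x d) (trans eq (⊕-comm d y)))

  x⊕1≢x : ∀ x → x ⊕ suc zero ≢ x
  x⊕1≢x x eq = case ⊕-cancelˡ x (trans eq (sym (⊕-identityʳ x))) of λ ()

  shift : Fin B → Permutation′ B
  shift d = Perm.permutation (_⊕ d) (_⊕ ⊖ d) (λ x → ⊖-⊕-cancel x d) (λ x → ⊕-⊖-cancel x d)

  ⊕1-induction : ∀ {P : Fin B → Set} → P zero → (∀ x → P x → P (x ⊕ suc zero)) → ∀ x → P x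
  ⊕1-induction {P} base step x = subst P (fromℕ<-toℕ x (toℕ<n x)) (go (toℕ x) (toℕ<n x))
    where
    go : ∀ k (k<B : k < B) → P (fromℕ< k<B)
    go zero    k<B = base
    go (suc k) k<B = subst P (toℕ-injective (begin
        toℕ (fromℕ< k<B′ ⊕ suc zero)         ≡⟨ toℕ-⊕ (fromℕ< k<B′) (suc zero) ⟩
        (toℕ (fromℕ< k<B′) + 1) % B         ≡⟨ cong (λ z → (z + 1) % B) (toℕ-fromℕ< k<B′) ⟩
        (k + 1) % B                         ≡⟨ cong (_% B) (+-comm k 1) ⟩
        suc k % B                           ≡⟨ m<n⇒m%n≡m k<B ⟩
        suc k                               ≡⟨ toℕ-fromℕ< k<B ⟨
        toℕ (fromℕ< k<B)                    ∎))
      (step _ (go k k<B′))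
      where
      open ≡-Reasoning
      k<B′ : k < B
      k<B′ = <⇒≤ k<B

  digit : ℕ → ℕ → Fin B
  digit zero    m = m mod B
  digit (suc t) m = digit t (m / B)

  digit-zero : ∀ t → digit t 0 ≡ zero
  digit-zero zero    = refl
  digit-zero (suc t) = digit-zero t

  digits-injective : ∀ ℓ {m m′} → m < B ^ ℓ → m′ < B ^ ℓ →
    (∀ t → t < ℓ → digit t m ≡ digit t m′) → m ≡ m′
  digits-injective zero    m<1 m′<1 same = trans (n<1⇒n≡0 m<1) (sym (n<1⇒n≡0 m′<1))
  digits-injective (suc ℓ) {m} {m′} m< m′< same = begin
    m                     ≡⟨ m≡m%n+[m/n]*n m B ⟩
    m % B + (m / B) * B   ≡⟨ cong₂ (λ u v → u + v * B) last-digit quotients ⟩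
    m′ % B + (m′ / B) * B ≡⟨ m≡m%n+[m/n]*n m′ B ⟨
    m′                    ∎
    where
    open ≡-Reasoning
    last-digit : m % B ≡ m′ % B
    last-digit = trans (sym (toℕ-mod m)) (trans (cong toℕ (same 0 (s≤s z≤n))) (toℕ-mod m′))
    quotient< : ∀ {k} → k < B ^ suc ℓ → k / B < B ^ ℓ
    quotient< {k} k< = m<n*o⇒m/o<n (subst (k <_) (*-comm B (B ^ ℓ)) k<)
    quotients : m / B ≡ m′ / B
    quotients = digits-injective ℓ (quotient< m<) (quotient< m′<) (λ t t<ℓ → same (suc t) (s≤s t<ℓ))

  digits : ∀ {a ℓ} → Fin a → Fin ℓ → Fin B
  digits r t = digit (toℕ t) (toℕ r)

  digits-zero : ∀ {a ℓ} (t : Fin ℓ) → digits {suc a} zero t ≡ zero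
  digits-zero t = digit-zero (toℕ t)

  digits-injective-on-Fin : ∀ {a ℓ} → a ≤ B ^ ℓ → ∀ (r r′ : Fin a) → (∀ t → digits {ℓ = ℓ} r t ≡ digits r′ t) → r ≡ r′
  digits-injective-on-Fin {ℓ = ℓ} a≤ r r′ same = toℕ-injective
    (digits-injective ℓ (<-≤-trans (toℕ<n r) a≤) (<-≤-trans (toℕ<n r′) a≤)
      (λ t t<ℓ → subst (λ u → digit u (toℕ r) ≡ digit u (toℕ r′)) (toℕ-fromℕ< t<ℓ) (same (fromℕ< t<ℓ))))

-- The column, coded and twisted partitions

fixed-all-but-one : ∀ {m} (f : Fin m → Fin m) → (∀ {i j} → f i ≡ f j → i ≡ j) →
  ∀ c₀ → (∀ c → c ≢ c₀ → f c ≡ c) → ∀ c → f c ≡ c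
fixed-all-but-one f f-injective c₀ fixed c with c ≟ c₀
... | no  c≢c₀ = fixed c c≢c₀
... | yes refl with f c₀ ≟ c₀
...   | yes fc₀≡c₀ = fc₀≡c₀
...   | no  fc₀≢c₀ = contradiction (f-injective (fixed (f c₀) fc₀≢c₀)) fc₀≢c₀

module Grid (a n ℓ : ℕ) (code : Fin (suc a) → Fin ℓ → Fin (2 + n))
            (code-injective : ∀ r r′ → (∀ t → code r t ≡ code r′ t) → r ≡ r′)
            (code-zero : ∀ t → code zero t ≡ zero)
            (twist : Fin (suc a) → Permutation′ (2 + n)) where

  open Cyclic n public
  open Coordinates (suc a) (2 + n) public

  Point : Set
  Point = Fin (suc a * (2 + n))

  columns : Partition (suc a) (2 + n)
  columns = rowPartition (λ _ → Perm.id)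

  coded : Fin ℓ → Partition (suc a) (2 + n)
  coded t = rowPartition (λ r → shift (code r t))

  twisted : Partition (suc a) (2 + n)
  twisted = rowPartition twist

  partitions : List (Partition (suc a) (2 + n))
  partitions = columns ∷ twisted ∷ tabulate coded

  length-partitions : length partitions ≡ ℓ + 2
  length-partitions = trans (cong (λ m → 2 + m) (length-tabulate coded)) (+-comm 2 ℓ)

  codedLabel : Fin ℓ → Point → Fin (2 + n)
  codedLabel t = proj₁ (coded t)

  codedLabel-row : ∀ {x r} t → row x ≡ r → codedLabel t x ≡ col x ⊕ code r t
  codedLabel-row {x} t = cong (λ r → col x ⊕ code r t)

  codedLabel-cell : ∀ t r c → codedLabel t (cell r c) ≡ c ⊕ code r t
  codedLabel-cell t = rowLabel-cell (λ r → shift (code r t))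

  codedLabel-row-zero : ∀ t c → codedLabel t (cell zero c) ≡ c
  codedLabel-row-zero t c = trans (codedLabel-cell t zero c) (trans (cong (c ⊕_) (code-zero t)) (⊕-identityʳ c))

  twistLabel : Point → Fin (2 + n)
  twistLabel = proj₁ twisted

  twistLabel-cell : ∀ r c → twistLabel (cell r c) ≡ twist r ⟨$⟩ʳ c
  twistLabel-cell = rowLabel-cell twist

  twistLabel-row : ∀ {x r} → row x ≡ r → twistLabel x ≡ twist r ⟨$⟩ʳ col x
  twistLabel-row {x} = cong (λ r → twist r ⟨$⟩ʳ col x)

  distinct-in-column : ∀ {x y} → col x ≡ col y → x ≢ y → row x ≢ row y
  distinct-in-column col≡ x≢y row≡ = x≢y (≡-by-coordinates row≡ col≡)

  separating : ∀ x y → col x ≡ col y → (∀ t → codedLabel t x ≡ codedLabel t y) → x ≡ y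
  separating x y col≡ coded≡ = ≡-by-coordinates
    (code-injective (row x) (row y) (λ t → ⊕-cancelˡ (col x)
      (trans (coded≡ t) (cong (_⊕ code (row y) t) (sym col≡)))))
    col≡

  Partner : Point → Point → Set
  Partner x y = y ≢ x × col y ≡ col x × twistLabel y ≡ twistLabel x

  Ordinary : Point → Set
  Ordinary x = twistLabel x ≡ col x

  Deviant : Point → Set
  Deviant x = ¬ Ordinary x

  ordinary-from-partner : ∀ {x y} → Partner x y → Ordinary y → Ordinary x
  ordinary-from-partner (_ , col≡ , twist≡) ordinary-y = trans (sym twist≡) (trans ordinary-y col≡)

  partner-in-row : ∀ x r → twist r ⟨$⟩ʳ col x ≡ col x → r ≢ row x → Ordinary x → Partner x (cell r (col x))
  partner-in-row x r fixed r≢ ordinary =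
    (λ eq → r≢ (trans (sym (row-cell r (col x))) (cong row eq))) ,
    col-cell r (col x) ,
    trans (twistLabel-cell r (col x)) (trans fixed (sym ordinary))

  HasPartner : Point → Set
  HasPartner x = ∃ (Partner x)

  HasTwoPartners : Point → Set
  HasTwoPartners x = ∃₂ λ y z → Partner x y × Partner x z × y ≢ z

  module Stabilizer (σ : Permutation′ (suc a * (2 + n)))
                    (fixes : ∀ P → P ∈ partitions → Fixes σ P) where

    S : Point → Point
    S x = σ ⟨$⟩ʳ x

    S-injective : ∀ {x y} → S x ≡ S y → x ≡ y
    S-injective {x} {y} eq = trans (sym (inverseˡ σ)) (trans (cong (σ ⟨$⟩ˡ_) eq) (inverseˡ σ))

    S⁻¹ : Point → Point
    S⁻¹ x = σ ⟨$⟩ˡ x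

    S-S⁻¹ : ∀ y → S (S⁻¹ y) ≡ y
    S-S⁻¹ y = inverseʳ σ

    module OnColumns = InducedPermutation σ columns (fixes columns (here refl))
    module OnTwisted = InducedPermutation σ twisted (fixes twisted (there (here refl)))
    module OnCoded (t : Fin ℓ) = InducedPermutation σ (coded t) (fixes (coded t) (there (there (∈-tabulate⁺ {f = coded} t))))

    β : Fin (2 + n) → Fin (2 + n)
    β = OnColumns.α

    col-S : ∀ x → col (S x) ≡ β (col x)
    col-S = OnColumns.α-law

    β-surjective : ∀ v → ∃ λ c → β c ≡ v
    β-surjective v = col x , (begin
      β (col x)               ≡⟨ col-S x ⟨
      col (S x)               ≡⟨ cong col (S-S⁻¹ (cell zero v)) ⟩
      col (cell zero v)       ≡⟨ col-cell zero v ⟩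
      v                       ∎)
      where
      open ≡-Reasoning
      x = S⁻¹ (cell zero v)

    Partner-S : ∀ {x y} → Partner x y → Partner (S x) (S y)
    Partner-S {x} {y} (y≢x , col≡ , twist≡) =
      (λ eq → y≢x (S-injective eq)) ,
      Equivalence.from (fixes columns (here refl) y x) col≡ ,
      Equivalence.from (fixes twisted (there (here refl)) y x) twist≡

    Partner-S⁻ : ∀ {x y} → Partner (S x) (S y) → Partner x y
    Partner-S⁻ {x} {y} (y≢x , col≡ , twist≡) =
      (λ eq → y≢x (cong S eq)) ,
      Equivalence.to (fixes columns (here refl) y x) col≡ ,
      Equivalence.to (fixes twisted (there (here refl)) y x) twist≡

    Partner-S⁻¹ : ∀ {x y} → Partner (S x) y → Partner x (S⁻¹ y)
    Partner-S⁻¹ {x} {y} p = Partner-S⁻ (subst (Partner (S x)) (sym (S-S⁻¹ y)) p)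

    HasPartner-S : ∀ {x} → HasPartner x → HasPartner (S x)
    HasPartner-S (y , p) = S y , Partner-S p

    HasPartner-S⁻ : ∀ {x} → HasPartner (S x) → HasPartner x
    HasPartner-S⁻ (y , p) = S⁻¹ y , Partner-S⁻¹ p

    HasTwoPartners-S : ∀ {x} → HasTwoPartners x → HasTwoPartners (S x)
    HasTwoPartners-S (y , z , p , p′ , y≢z) = S y , S z , Partner-S p , Partner-S p′ , λ eq → y≢z (S-injective eq)

    HasTwoPartners-S⁻ : ∀ {x} → HasTwoPartners (S x) → HasTwoPartners x
    HasTwoPartners-S⁻ (y , z , p , p′ , y≢z) = S⁻¹ y , S⁻¹ z , Partner-S⁻¹ p , Partner-S⁻¹ p′ ,
      λ eq → y≢z (trans (sym (S-S⁻¹ y)) (trans (cong S eq) (S-S⁻¹ z)))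

    twistLabel-S-via-ordinary-row : ∀ r → (∀ c → twist r ⟨$⟩ʳ c ≡ c) → (∀ c → Ordinary (S (cell r c))) →
      ∀ x → twistLabel (S x) ≡ β (twistLabel x)
    twistLabel-S-via-ordinary-row r identity-row ordinary x = trans (OnTwisted.α-law x) (α≗β (twistLabel x))
      where
      α≗β : ∀ v → OnTwisted.α v ≡ β v
      α≗β v = begin
        OnTwisted.α v                        ≡⟨ cong OnTwisted.α (trans (twistLabel-cell r v) (identity-row v)) ⟨
        OnTwisted.α (twistLabel (cell r v))  ≡⟨ OnTwisted.α-law (cell r v) ⟨
        twistLabel (S (cell r v))            ≡⟨ ordinary v ⟩
        col (S (cell r v))                   ≡⟨ col-S (cell r v) ⟩
        β (col (cell r v))                   ≡⟨ cong β (col-cell r v) ⟩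
        β v                                  ∎
        where open ≡-Reasoning

    trivial-if-fixes-row-zero-but-one : ∀ c₀ → (∀ c → c ≢ c₀ → S (cell zero c) ≡ cell zero c) → ∀ x → S x ≡ x
    trivial-if-fixes-row-zero-but-one c₀ fixed x =
      separating (S x) x
        (trans (col-S x) (trivial-on-labels col β col-S OnColumns.α-injective (col-cell zero) (col x)))
        (λ t → trans (OnCoded.α-law t x) (trivial-on-labels (codedLabel t) (OnCoded.α t)
          (OnCoded.α-law t) (OnCoded.α-injective t) (codedLabel-row-zero t) (codedLabel t x)))
      where
      trivial-on-labels : ∀ (label : Point → Fin (2 + n)) (α : Fin (2 + n) → Fin (2 + n)) →
        (∀ x → label (S x) ≡ α (label x)) → (∀ {i j} → α i ≡ α j → i ≡ j) →
        (∀ c → label (cell zero c) ≡ c) → ∀ c → α c ≡ c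
      trivial-on-labels label α α-law α-injective label-row-zero =
        fixed-all-but-one α α-injective c₀ λ c c≢c₀ → begin
          α c                        ≡⟨ cong α (label-row-zero c) ⟨
          α (label (cell zero c))    ≡⟨ α-law (cell zero c) ⟨
          label (S (cell zero c))    ≡⟨ cong label (fixed c c≢c₀) ⟩
          label (cell zero c)        ≡⟨ label-row-zero c ⟩
          c                          ∎
        where open ≡-Reasoning

    trivial-if-fixes-row-zero : (∀ c → S (cell zero c) ≡ cell zero c) → ∀ x → S x ≡ x
    trivial-if-fixes-row-zero fixed = trivial-if-fixes-row-zero-but-one zero (λ c _ → fixed c)

-- Twisting rows 0 and 1

module ShiftAndTwist (k n ℓ : ℕ) (fits : 3 + k ≤ (2 + n) ^ ℓ) (ρ : Permutation′ (2 + n)) where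

  twist : Fin (3 + k) → Permutation′ (2 + n)
  twist 0F            = Cyclic.shift n 1F
  twist 1F            = ρ
  twist (suc (suc r)) = Perm.id

  open Grid (2 + k) n ℓ (Cyclic.digits n)
    (Cyclic.digits-injective-on-Fin n fits) (Cyclic.digits-zero n {2 + k}) twist public

  deviant-row : ∀ x → Deviant x → row x ≡ 0F ⊎ row x ≡ 1F
  deviant-row x deviant with row x
  ... | 0F          = inj₁ refl
  ... | 1F          = inj₂ refl
  ... | suc (suc r) = ⊥-elim (deviant refl)

  row-zero-deviant : ∀ c → Deviant (cell 0F c)
  row-zero-deviant c ordinary = x⊕1≢x c (trans (sym (twistLabel-cell 0F c)) (trans ordinary (col-cell 0F c)))

  Edge : Fin (2 + n) → Fin (2 + n) → Set
  Edge c v = v ≡ c ⊕ 1F ⊎ (ρ ⟨$⟩ʳ c ≢ c × v ≡ ρ ⟨$⟩ʳ c)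

  deviant-edge : ∀ x → Deviant x → Edge (col x) (twistLabel x)
  deviant-edge x deviant with deviant-row x deviant
  ... | inj₁ row≡0 = inj₁ (twistLabel-row row≡0)
  ... | inj₂ row≡1 = inj₂ ((λ fixed → deviant (trans (twistLabel-row row≡1) fixed)) , twistLabel-row row≡1)

  DeviantWith : Fin (2 + n) → Fin (2 + n) → Set
  DeviantWith c v = ∃ λ x → Deviant x × col x ≡ c × twistLabel x ≡ v

  edge-deviant : ∀ {c v} → Edge c v → DeviantWith c v
  edge-deviant {c} (inj₁ refl) = cell 0F c , row-zero-deviant c , col-cell 0F c , twistLabel-cell 0F c
  edge-deviant {c} (inj₂ (moved , refl)) =
    cell 1F c ,
    (λ ordinary → moved (trans (sym (twistLabel-cell 1F c)) (trans ordinary (col-cell 1F c)))) ,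
    col-cell 1F c , twistLabel-cell 1F c

  partner-of-deviant : ∀ {x y} → Partner x y → Deviant x → Deviant y → ρ ⟨$⟩ʳ col x ≡ col x ⊕ 1F
  partner-of-deviant {x} {y} (y≢x , col≡ , twist≡) dx dy with deviant-row x dx | deviant-row y dy
  ... | inj₁ x0 | inj₁ y0 = ⊥-elim (distinct-in-column col≡ y≢x (trans y0 (sym x0)))
  ... | inj₂ x1 | inj₂ y1 = ⊥-elim (distinct-in-column col≡ y≢x (trans y1 (sym x1)))
  ... | inj₁ x0 | inj₂ y1 = trans (cong (ρ ⟨$⟩ʳ_) (sym col≡)) (trans (sym (twistLabel-row y1)) (trans twist≡ (twistLabel-row x0)))
  ... | inj₂ x1 | inj₁ y0 = trans (sym (twistLabel-row x1)) (trans (sym twist≡) (trans (twistLabel-row y0) (cong (_⊕ 1F) col≡)))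

  Branching : Fin (2 + n) → Set
  Branching c = ∃₂ λ v w → Edge c v × Edge c w × v ≢ w

  branching-moved : ∀ {c} → Branching c → ρ ⟨$⟩ʳ c ≢ c
  branching-moved (v , w , inj₁ refl , inj₁ refl , v≢w) fixed = v≢w refl
  branching-moved (v , w , inj₁ _ , inj₂ (moved , _) , _) = moved
  branching-moved (v , w , inj₂ (moved , _) , _ , _) = moved

  moved-branching : ∀ {c} → ρ ⟨$⟩ʳ c ≢ c → ρ ⟨$⟩ʳ c ≢ c ⊕ 1F → Branching c
  moved-branching {c} moved no-collision = c ⊕ 1F , ρ ⟨$⟩ʳ c , inj₁ refl , inj₂ (moved , refl) , λ eq → no-collision (sym eq)

  module Analysis (σ : Permutation′ ((3 + k) * (2 + n)))
                  (fixes : ∀ P → P ∈ partitions → Fixes σ P)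
                  (ordinary-S : ∀ x → Ordinary x → Ordinary (σ ⟨$⟩ʳ x))
                  (ordinary-S⁻ : ∀ x → Ordinary (σ ⟨$⟩ʳ x) → Ordinary x) where

    open Stabilizer σ fixes public

    twistLabel-S : ∀ x → twistLabel (S x) ≡ β (twistLabel x)
    twistLabel-S = twistLabel-S-via-ordinary-row 2F (λ _ → refl) λ c →
      ordinary-S (cell 2F c) (trans (twistLabel-cell 2F c) (sym (col-cell 2F c)))

    Edge-β : ∀ {c v} → Edge c v → Edge (β c) (β v)
    Edge-β edge = image (edge-deviant edge)
      where
      image : ∀ {c v} → DeviantWith c v → Edge (β c) (β v)
      image (x , deviant , col≡ , twist≡) = subst₂ Edge
        (trans (col-S x) (cong β col≡)) (trans (twistLabel-S x) (cong β twist≡))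
        (deviant-edge (S x) λ ordinary → deviant (ordinary-S⁻ x ordinary))

    Edge-β⁻ : ∀ {c v} → Edge (β c) (β v) → Edge c v
    Edge-β⁻ edge = preimage (edge-deviant edge)
      where
      preimage : ∀ {c v} → DeviantWith (β c) (β v) → Edge c v
      preimage (y , deviant , col≡ , twist≡) = subst₂ Edge
        (OnColumns.α-injective (trans (sym (col-S (S⁻¹ y))) (trans (cong col (S-S⁻¹ y)) col≡)))
        (OnColumns.α-injective (trans (sym (twistLabel-S (S⁻¹ y))) (trans (cong twistLabel (S-S⁻¹ y)) twist≡)))
        (deviant-edge (S⁻¹ y) λ ordinary → deviant (subst Ordinary (S-S⁻¹ y) (ordinary-S (S⁻¹ y) ordinary)))

    row-zero-fixed : (∀ c → β c ≡ c) → ∀ c → ρ ⟨$⟩ʳ c ≢ c ⊕ 1F → S (cell 0F c) ≡ cell 0F c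
    row-zero-fixed β-id c no-collision =
      case deviant-row (S x) (λ ordinary → row-zero-deviant c (ordinary-S⁻ x ordinary)) of λ where
        (inj₁ row≡0) → ≡-by-coordinates (trans row≡0 (sym (row-cell 0F c))) (trans (col-S x) (β-id (col x)))
        (inj₂ row≡1) → ⊥-elim (no-collision (collision row≡1))
      where
      x = cell 0F c

      collision : row (S x) ≡ 1F → ρ ⟨$⟩ʳ c ≡ c ⊕ 1F
      collision row≡1 = begin
        ρ ⟨$⟩ʳ c           ≡⟨ cong (ρ ⟨$⟩ʳ_) (trans (col-S x) (trans (β-id (col x)) (col-cell 0F c))) ⟨
        ρ ⟨$⟩ʳ col (S x)   ≡⟨ twistLabel-row row≡1 ⟨
        twistLabel (S x)   ≡⟨ twistLabel-S x ⟩
        β (twistLabel x)   ≡⟨ β-id _ ⟩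
        twistLabel x       ≡⟨ twistLabel-cell 0F c ⟩
        c ⊕ 1F            ∎
        where open ≡-Reasoning

    Branching-β : ∀ {c} → Branching c → Branching (β c)
    Branching-β (v , w , edge-v , edge-w , v≢w) =
      β v , β w , Edge-β edge-v , Edge-β edge-w , λ eq → v≢w (OnColumns.α-injective eq)

    Branching-β⁻ : ∀ {c} → Branching (β c) → Branching c
    Branching-β⁻ (v , w , edge-v , edge-w , v≢w) =
      preimage (β-surjective v) (β-surjective w) edge-v edge-w v≢w
      where
      preimage : ∀ {c v w} → (∃ λ v′ → β v′ ≡ v) → (∃ λ w′ → β w′ ≡ w) →
        Edge (β c) v → Edge (β c) w → v ≢ w → Branching c
      preimage (v′ , refl) (w′ , refl) edge-v edge-w v≢w =
        v′ , w′ , Edge-β⁻ edge-v , Edge-β⁻ edge-w , λ eq → v≢w (cong β eq)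

module ShiftAndThreeCycle (k m ℓ : ℕ) (fits : 4 + k ≤ (4 + m) ^ ℓ) where

  ρ : Permutation′ (4 + m)
  ρ = Perm.transpose 0F 2F ∘ₚ Perm.transpose 0F 1F

  open ShiftAndTwist (suc k) (2 + m) ℓ fits ρ public

  no-collision : ∀ c → ρ ⟨$⟩ʳ c ≢ c ⊕ 1F
  no-collision 0F ()
  no-collision 1F ()
  no-collision 2F ()
  no-collision (suc (suc (suc c))) eq = x⊕1≢x _ (sym eq)

  Moved : Fin (4 + m) → Set
  Moved c = ρ ⟨$⟩ʳ c ≢ c

  moved-image : ∀ {c} → Moved c → Moved (ρ ⟨$⟩ʳ c)
  moved-image {c} moved eq = moved (trans (sym (inverseˡ ρ)) (trans (cong (ρ ⟨$⟩ˡ_) eq) (inverseˡ ρ)))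

  moved-cases : ∀ c → Moved c → c ≡ 0F ⊎ c ≡ 1F ⊎ c ≡ 2F
  moved-cases 0F _ = inj₁ refl
  moved-cases 1F _ = inj₂ (inj₁ refl)
  moved-cases 2F _ = inj₂ (inj₂ refl)
  moved-cases (suc (suc (suc c))) moved = ⊥-elim (moved refl)

  successor-moved : ∀ c v → Moved c → c ≢ 2F → Edge c v → Moved v
  successor-moved 0F _ _ _ (inj₁ refl)       = λ ()
  successor-moved 0F _ _ _ (inj₂ (_ , refl)) = λ ()
  successor-moved 1F _ _ _ (inj₁ refl)       = λ ()
  successor-moved 1F _ _ _ (inj₂ (_ , refl)) = λ ()
  successor-moved 2F _ _ c≢2 _               = ⊥-elim (c≢2 refl)
  successor-moved (suc (suc (suc c))) _ moved _ _ = ⊥-elim (moved refl)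

  other : Fin (4 + k) → Fin (4 + k)
  other 0F                  = 2F
  other 1F                  = 2F
  other 2F                  = 3F
  other (suc (suc (suc r))) = 2F

  other-≢ : ∀ r → other r ≢ r
  other-≢ 0F ()
  other-≢ 1F ()
  other-≢ 2F ()
  other-≢ (suc (suc (suc r))) ()

  other-ordinary : ∀ r c → twist (other r) ⟨$⟩ʳ c ≡ c
  other-ordinary 0F                  c = refl
  other-ordinary 1F                  c = refl
  other-ordinary 2F                  c = refl
  other-ordinary (suc (suc (suc r))) c = refl

  ordinary-partner : ∀ x → Ordinary x → HasPartner x
  ordinary-partner x ordinary =
    _ , partner-in-row x (other (row x)) (other-ordinary (row x) (col x)) (other-≢ (row x)) ordinary

  partner-ordinary : ∀ x → HasPartner x → Ordinary x
  partner-ordinary x (y , partner) with twistLabel x ≟ col x | twistLabel y ≟ col y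
  ... | yes ordinary | _           = ordinary
  ... | no deviant   | yes ordinary-y = ⊥-elim (deviant (ordinary-from-partner partner ordinary-y))
  ... | no deviant   | no deviant-y = ⊥-elim (no-collision (col x) (partner-of-deviant partner deviant deviant-y))

  module Stabilized (σ : Permutation′ ((4 + k) * (4 + m))) (fixes : ∀ P → P ∈ partitions → Fixes σ P) where

    private module St = Stabilizer σ fixes

    open Analysis σ fixes
      (λ x ordinary → partner-ordinary (St.S x) (St.HasPartner-S (ordinary-partner x ordinary)))
      (λ x ordinary → partner-ordinary x (St.HasPartner-S⁻ (ordinary-partner (St.S x) ordinary)))

    Moved-β : ∀ {c} → Moved c → Moved (β c)
    Moved-β {c} moved = branching-moved (Branching-β (moved-branching moved (no-collision c)))

    Moved-β⁻ : ∀ {c} → Moved (β c) → Moved c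
    Moved-β⁻ {c} moved = branching-moved (Branching-β⁻ (moved-branching moved (no-collision (β c))))

    -- The moved points 0, 1, 2 are the branching ones, and only 2 has an edge leaving them.
    β2 : β 2F ≡ 2F
    β2 = decidable-stable (β 2F ≟ 2F) λ β2≢2 →
      Moved-β⁻ (successor-moved (β 2F) (β 3F) (Moved-β (λ ())) β2≢2 (Edge-β (inj₁ refl))) refl

    β1 : β 1F ≡ 1F
    β1 = case subst (λ c → Edge c (β 1F)) β2 (Edge-β {2F} (inj₂ ((λ ()) , refl))) of λ where
      (inj₁ β1≡3)       → ⊥-elim (Moved-β {1F} (λ ()) (subst (λ d → ρ ⟨$⟩ʳ d ≡ d) (sym β1≡3) refl))
      (inj₂ (_ , β1≡1)) → β1≡1

    β0 : β 0F ≡ 0F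
    β0 = case moved-cases (β 0F) (Moved-β (λ ())) of λ where
      (inj₁ β0≡0)        → β0≡0
      (inj₂ (inj₁ β0≡1)) → case OnColumns.α-injective (trans β0≡1 (sym β1)) of λ ()
      (inj₂ (inj₂ β0≡2)) → case OnColumns.α-injective (trans β0≡2 (sym β2)) of λ ()

    β-fixes-moved : ∀ c → Moved c → β c ≡ c
    β-fixes-moved c moved = case moved-cases c moved of λ where
      (inj₁ refl)        → β0
      (inj₂ (inj₁ refl)) → β1
      (inj₂ (inj₂ refl)) → β2

    β-id : ∀ c → β c ≡ c
    β-id = ⊕1-induction β0 λ c βc≡c →
      case subst (λ d → Edge d (β (c ⊕ 1F))) βc≡c (Edge-β (inj₁ refl)) of λ where
        (inj₁ β≡)          → β≡
        (inj₂ (moved , β≡)) → ⊥-elim (no-collision c (sym (OnColumns.α-injective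
          (trans β≡ (sym (β-fixes-moved (ρ ⟨$⟩ʳ c) (moved-image moved)))))))

    trivial : ∀ x → S x ≡ x
    trivial = trivial-if-fixes-row-zero (λ c → row-zero-fixed β-id c (no-collision c))

  isBase : IsBase partitions
  isBase = Stabilized.trivial

module ShiftAndSwap (k ℓ : ℕ) (fits : 5 + k ≤ 3 ^ ℓ) where

  ρ : Permutation′ 3
  ρ = Perm.transpose 0F 1F

  open ShiftAndTwist (2 + k) 1 ℓ fits ρ public

  -- The deviant cells (0,0) and (1,0) are partners here, so ordinary cells are recognised
  -- by having two partners; this is what needs three ordinary rows.

  no-collision : ∀ c → c ≢ 0F → ρ ⟨$⟩ʳ c ≢ c ⊕ 1F
  no-collision 0F c≢0 = ⊥-elim (c≢0 refl)
  no-collision 1F _ ()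
  no-collision 2F _ ()

  edge? : ∀ c v → Dec (Edge c v)
  edge? c v = (v ≟ c ⊕ 1F) ⊎-dec (¬? (ρ ⟨$⟩ʳ c ≟ c) ×-dec (v ≟ ρ ⟨$⟩ʳ c))

  rigid : ∀ x₀ x₁ x₂ → Edge x₀ x₁ → Edge x₁ x₂ → Edge x₂ x₀ → Edge x₁ x₀ → x₀ ≡ 0F × x₁ ≡ 1F × x₂ ≡ 2F
  rigid = from-yes (all? λ x₀ → all? λ x₁ → all? λ x₂ →
    edge? x₀ x₁ →-dec edge? x₁ x₂ →-dec edge? x₂ x₀ →-dec edge? x₁ x₀ →-dec
    ((x₀ ≟ 0F) ×-dec (x₁ ≟ 1F) ×-dec (x₂ ≟ 2F)))

  others : Fin (5 + k) → Fin (5 + k) × Fin (5 + k)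
  others 2F = 3F , 4F
  others 3F = 2F , 4F
  others 4F = 2F , 3F
  others 0F = 2F , 3F
  others 1F = 2F , 3F
  others (suc (suc (suc (suc (suc r))))) = 2F , 3F

  others-distinct : ∀ r → proj₁ (others r) ≢ r × proj₂ (others r) ≢ r × proj₁ (others r) ≢ proj₂ (others r)
  others-distinct 0F = (λ ()) , (λ ()) , (λ ())
  others-distinct 1F = (λ ()) , (λ ()) , (λ ())
  others-distinct 2F = (λ ()) , (λ ()) , (λ ())
  others-distinct 3F = (λ ()) , (λ ()) , (λ ())
  others-distinct 4F = (λ ()) , (λ ()) , (λ ())
  others-distinct (suc (suc (suc (suc (suc r))))) = (λ ()) , (λ ()) , (λ ())

  others-ordinary : ∀ r c → twist (proj₁ (others r)) ⟨$⟩ʳ c ≡ c × twist (proj₂ (others r)) ⟨$⟩ʳ c ≡ c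
  others-ordinary 0F c = refl , refl
  others-ordinary 1F c = refl , refl
  others-ordinary 2F c = refl , refl
  others-ordinary 3F c = refl , refl
  others-ordinary 4F c = refl , refl
  others-ordinary (suc (suc (suc (suc (suc r))))) c = refl , refl

  ordinary-partners : ∀ x → Ordinary x → HasTwoPartners x
  ordinary-partners x ordinary =
    cell r₁ (col x) , cell r₂ (col x) ,
    partner-in-row x r₁ (proj₁ (others-ordinary (row x) (col x))) r₁≢ ordinary ,
    partner-in-row x r₂ (proj₂ (others-ordinary (row x) (col x))) r₂≢ ordinary ,
    λ eq → r₁≢r₂ (proj₁ (cell-injective eq))
    where
    r₁ = proj₁ (others (row x))
    r₂ = proj₂ (others (row x))
    r₁≢ = proj₁ (others-distinct (row x))
    r₂≢ = proj₁ (proj₂ (others-distinct (row x)))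
    r₁≢r₂ = proj₂ (proj₂ (others-distinct (row x)))

  partners-ordinary : ∀ x → HasTwoPartners x → Ordinary x
  partners-ordinary x (y , z , partner-y@(y≢x , col-y , _) , partner-z@(z≢x , col-z , _) , y≢z)
    with twistLabel x ≟ col x | twistLabel y ≟ col y | twistLabel z ≟ col z
  ... | yes ordinary | _ | _ = ordinary
  ... | no deviant | yes ordinary-y | _ = ⊥-elim (deviant (ordinary-from-partner partner-y ordinary-y))
  ... | no deviant | no _ | yes ordinary-z = ⊥-elim (deviant (ordinary-from-partner partner-z ordinary-z))
  ... | no deviant | no deviant-y | no deviant-z =
    ⊥-elim (two-rows (deviant-row x deviant) (deviant-row y deviant-y) (deviant-row z deviant-z)
      (distinct-in-column (sym col-y) (λ eq → y≢x (sym eq)))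
      (distinct-in-column (sym col-z) (λ eq → z≢x (sym eq)))
      (distinct-in-column (trans col-y (sym col-z)) y≢z))
    where
    two-rows : ∀ {r s t : Fin (5 + k)} → r ≡ 0F ⊎ r ≡ 1F → s ≡ 0F ⊎ s ≡ 1F → t ≡ 0F ⊎ t ≡ 1F →
      r ≢ s → r ≢ t → s ≢ t → ⊥
    two-rows (inj₁ refl) (inj₁ refl) _ r≢s _ _ = r≢s refl
    two-rows (inj₂ refl) (inj₂ refl) _ r≢s _ _ = r≢s refl
    two-rows (inj₁ refl) _ (inj₁ refl) _ r≢t _ = r≢t refl
    two-rows (inj₂ refl) _ (inj₂ refl) _ r≢t _ = r≢t refl
    two-rows (inj₁ refl) (inj₂ refl) (inj₂ refl) _ _ s≢t = s≢t refl
    two-rows (inj₂ refl) (inj₁ refl) (inj₁ refl) _ _ s≢t = s≢t refl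

  module Stabilized (σ : Permutation′ ((5 + k) * 3)) (fixes : ∀ P → P ∈ partitions → Fixes σ P) where

    private module St = Stabilizer σ fixes

    open Analysis σ fixes
      (λ x ordinary → partners-ordinary (St.S x) (St.HasTwoPartners-S (ordinary-partners x ordinary)))
      (λ x ordinary → partners-ordinary x (St.HasTwoPartners-S⁻ (ordinary-partners (St.S x) ordinary)))

    fixed : β 0F ≡ 0F × β 1F ≡ 1F × β 2F ≡ 2F
    fixed = rigid (β 0F) (β 1F) (β 2F)
      (Edge-β (inj₁ refl)) (Edge-β (inj₁ refl)) (Edge-β (inj₁ refl)) (Edge-β (inj₂ ((λ ()) , refl)))

    β-id : ∀ c → β c ≡ c
    β-id 0F = proj₁ fixed
    β-id 1F = proj₁ (proj₂ fixed)
    β-id 2F = proj₂ (proj₂ fixed)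

    trivial : ∀ x → S x ≡ x
    trivial = trivial-if-fixes-row-zero-but-one 0F (λ c c≢0 → row-zero-fixed β-id c (no-collision c c≢0))

  isBase : IsBase partitions
  isBase = Stabilized.trivial

-- Three rows

4-mod-≢-1 : ∀ m → 4 mod (4 + m) ≢ 1F
4-mod-≢-1 zero    ()
4-mod-≢-1 (suc m) ()

-- Row 0 is the only row without partners, so σ preserves it; the single coded partition
-- then makes β a translation, and translations commuting with π are trivial.
module ThreeRows (m : ℕ) where

  π : Permutation′ (4 + m)
  π = Perm.transpose 0F 1F ∘ₚ Perm.transpose 0F 2F ∘ₚ Cyclic.shift (2 + m) 1F

  twist : Fin 3 → Permutation′ (4 + m)
  twist 0F = π
  twist 1F = Perm.id
  twist 2F = Perm.id

  open Grid 2 (2 + m) 1 (Cyclic.digits (2 + m))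
    (Cyclic.digits-injective-on-Fin (2 + m) (s≤s (s≤s (s≤s z≤n)))) (Cyclic.digits-zero (2 + m) {2}) twist public

  π-derangement : ∀ c → π ⟨$⟩ʳ c ≢ c
  π-derangement 0F ()
  π-derangement 1F ()
  π-derangement 2F ()
  π-derangement (suc (suc (suc c))) = x⊕1≢x _

  translation-commuting-with-π : ∀ k → π ⟨$⟩ʳ k ≡ 2F ⊕ k → π ⟨$⟩ʳ (1F ⊕ k) ≡ 3F ⊕ k → k ≡ 0F
  translation-commuting-with-π 0F _ _ = refl
  translation-commuting-with-π 1F _ eq = ⊥-elim (4-mod-≢-1 m (sym eq))
  translation-commuting-with-π 2F eq _ = ⊥-elim (4-mod-≢-1 m (sym eq))
  translation-commuting-with-π (suc (suc (suc k))) eq _ =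
    case ⊕-cancelˡ (suc (suc (suc k))) (trans eq (⊕-comm 2F (suc (suc (suc k))))) of λ ()

  step-digit : Fin 3 → Fin (4 + m)
  step-digit r = digits {ℓ = 1} r 0F

  no-wraparound : ∀ r → r ≢ 0F → 2F ⊕ step-digit r ≢ 1F
  no-wraparound 0F r≢0 = ⊥-elim (r≢0 refl)
  no-wraparound 1F _   = λ ()
  no-wraparound 2F _   = 4-mod-≢-1 m

  other : Fin 3 → Fin 3
  other 0F = 1F
  other 1F = 2F
  other 2F = 1F

  other-≢ : ∀ r → r ≢ 0F → other r ≢ r
  other-≢ 0F r≢0 = ⊥-elim (r≢0 refl)
  other-≢ 1F _ ()
  other-≢ 2F _ ()

  other-identity : ∀ r c → twist (other r) ⟨$⟩ʳ c ≡ c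
  other-identity 0F c = refl
  other-identity 1F c = refl
  other-identity 2F c = refl

  ordinary-row : ∀ x → row x ≢ 0F → Ordinary x
  ordinary-row x row≢0 with row x
  ... | 0F = ⊥-elim (row≢0 refl)
  ... | 1F = refl
  ... | 2F = refl

  partner-row : ∀ x → HasPartner x → row x ≢ 0F
  partner-row x (y , partner@(y≢x , col≡ , _)) row≡0 with row y ≟ 0F
  ... | yes row-y≡0 = distinct-in-column col≡ y≢x (trans row-y≡0 (sym row≡0))
  ... | no  row-y≢0 = π-derangement (col x)
    (trans (sym (twistLabel-row row≡0)) (ordinary-from-partner partner (ordinary-row y row-y≢0)))

  row-partner : ∀ x → row x ≢ 0F → HasPartner x
  row-partner x row≢0 = cell (other (row x)) (col x) ,
    partner-in-row x (other (row x)) (other-identity (row x) (col x)) (other-≢ (row x) row≢0) (ordinary-row x row≢0)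

  module Stabilized (σ : Permutation′ (3 * (4 + m))) (fixes : ∀ P → P ∈ partitions → Fixes σ P) where

    open Stabilizer σ fixes

    row-zero-S : ∀ x → row x ≡ 0F → row (S x) ≡ 0F
    row-zero-S x row≡0 = decidable-stable (row (S x) ≟ 0F) λ row-Sx≢0 →
      partner-row x (HasPartner-S⁻ (row-partner (S x) row-Sx≢0)) row≡0

    row-nonzero-S : ∀ x → row x ≢ 0F → row (S x) ≢ 0F
    row-nonzero-S x row≢0 = partner-row (S x) (HasPartner-S (row-partner x row≢0))

    twistLabel-S : ∀ x → twistLabel (S x) ≡ β (twistLabel x)
    twistLabel-S = twistLabel-S-via-ordinary-row 1F (λ _ → refl) λ c →
      ordinary-row (S (cell 1F c)) (row-nonzero-S (cell 1F c) λ eq → case trans (sym (row-cell 1F c)) eq of λ ())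

    β-commutes-with-π : ∀ c → β (π ⟨$⟩ʳ c) ≡ π ⟨$⟩ʳ β c
    β-commutes-with-π c = begin
      β (π ⟨$⟩ʳ c)         ≡⟨ cong β (twistLabel-cell 0F c) ⟨
      β (twistLabel x)     ≡⟨ twistLabel-S x ⟨
      twistLabel (S x)     ≡⟨ twistLabel-row (row-zero-S x (row-cell 0F c)) ⟩
      π ⟨$⟩ʳ col (S x)     ≡⟨ cong (π ⟨$⟩ʳ_) (trans (col-S x) (cong β (col-cell 0F c))) ⟩
      π ⟨$⟩ʳ β c           ∎
      where
      open ≡-Reasoning
      x = cell 0F c

    coded-α≗β : ∀ c → OnCoded.α 0F c ≡ β c
    coded-α≗β c = begin
      OnCoded.α 0F c                              ≡⟨ cong (OnCoded.α 0F) (codedLabel-row-zero 0F c) ⟨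
      OnCoded.α 0F (codedLabel 0F x)              ≡⟨ OnCoded.α-law 0F x ⟨
      codedLabel 0F (S x)                         ≡⟨ codedLabel-row 0F (row-zero-S x (row-cell 0F c)) ⟩
      col (S x) ⊕ zero                            ≡⟨ ⊕-identityʳ (col (S x)) ⟩
      col (S x)                                   ≡⟨ trans (col-S x) (cong β (col-cell 0F c)) ⟩
      β c                                         ∎
      where
      open ≡-Reasoning
      x = cell 0F c

    β-step : ∀ r c → β (c ⊕ step-digit r) ≡ β c ⊕ step-digit (row (S (cell r c)))
    β-step r c = begin
      β (c ⊕ step-digit r)                      ≡⟨ coded-α≗β _ ⟨
      OnCoded.α 0F (c ⊕ step-digit r)           ≡⟨ cong (OnCoded.α 0F) (codedLabel-cell 0F r c) ⟨
      OnCoded.α 0F (codedLabel 0F x)            ≡⟨ OnCoded.α-law 0F x ⟨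
      codedLabel 0F (S x)                       ≡⟨ cong (_⊕ step-digit (row (S x))) (trans (col-S x) (cong β (col-cell r c))) ⟩
      β c ⊕ step-digit (row (S x))              ∎
      where
      open ≡-Reasoning
      x = cell r c

    same-image-row : ∀ {x y} → row (S x) ≡ row (S y) → col x ≡ col y → x ≡ y
    same-image-row {x} {y} row≡ col≡ =
      S-injective (≡-by-coordinates row≡ (trans (col-S x) (trans (cong β col≡) (sym (col-S y)))))

    -- If S sent (1,c) to row 2 it would send (2,c) to row 1: β would turn c ↦ c ⊕ 1F into
    -- adding 2 and c ↦ c ⊕ 2F into adding 1, so the step from c ⊕ 1F would add b − 1 ∉ {1, 2}.
    β-⊕1 : ∀ c → β (c ⊕ 1F) ≡ β c ⊕ 1F
    β-⊕1 c = from-row (row (S (cell 1F c))) refl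
      where
      nonzero : ∀ r {d} → r ≢ 0F → row (S (cell r d)) ≢ 0F
      nonzero r {d} r≢0 = row-nonzero-S (cell r d) λ eq → r≢0 (trans (sym (row-cell r d)) eq)

      swapped : row (S (cell 1F c)) ≡ 2F → row (S (cell 2F c)) ≡ 1F → ⊥
      swapped r₁ r₂ = no-wraparound r′ (nonzero 1F (λ ())) (sym (⊕-cancelˡ (β c) (begin
        β c ⊕ 1F                     ≡⟨ cong (λ r → β c ⊕ step-digit r) r₂ ⟨
        β c ⊕ step-digit (row (S (cell 2F c)))  ≡⟨ β-step 2F c ⟨
        β (c ⊕ 2F)                   ≡⟨ cong β (⊕-assoc c 1F 1F) ⟨
        β (c ⊕ 1F ⊕ 1F)              ≡⟨ β-step 1F (c ⊕ 1F) ⟩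
        β (c ⊕ 1F) ⊕ step-digit r′   ≡⟨ cong (_⊕ step-digit r′) (trans (β-step 1F c) (cong (λ r → β c ⊕ step-digit r) r₁)) ⟩
        β c ⊕ 2F ⊕ step-digit r′     ≡⟨ ⊕-assoc (β c) 2F (step-digit r′) ⟩
        β c ⊕ (2F ⊕ step-digit r′)   ∎)))
        where
        open ≡-Reasoning
        r′ = row (S (cell 1F (c ⊕ 1F)))

      from-row : ∀ r → row (S (cell 1F c)) ≡ r → β (c ⊕ 1F) ≡ β c ⊕ 1F
      from-row 0F r₁ = ⊥-elim (nonzero 1F (λ ()) r₁)
      from-row 1F r₁ = trans (β-step 1F c) (cong (λ r → β c ⊕ step-digit r) r₁)
      from-row 2F r₁ = ⊥-elim (second-row (row (S (cell 2F c))) refl)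
        where
        second-row : ∀ r → row (S (cell 2F c)) ≡ r → ⊥
        second-row 0F r₂ = nonzero 2F (λ ()) r₂
        second-row 1F r₂ = swapped r₁ r₂
        second-row 2F r₂ = case proj₁ (cell-injective (same-image-row (trans r₁ (sym r₂))
                                  (trans (col-cell 1F c) (sym (col-cell 2F c))))) of λ ()

    β-translation : ∀ c → β c ≡ c ⊕ β 0F
    β-translation = ⊕1-induction (sym (⊕-identityˡ (β 0F))) λ c βc≡ → begin
      β (c ⊕ 1F)        ≡⟨ β-⊕1 c ⟩
      β c ⊕ 1F          ≡⟨ cong (_⊕ 1F) βc≡ ⟩
      c ⊕ β 0F ⊕ 1F     ≡⟨ ⊕-assoc c (β 0F) 1F ⟩
      c ⊕ (β 0F ⊕ 1F)   ≡⟨ cong (c ⊕_) (⊕-comm (β 0F) 1F) ⟩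
      c ⊕ (1F ⊕ β 0F)   ≡⟨ ⊕-assoc c 1F (β 0F) ⟨
      c ⊕ 1F ⊕ β 0F     ∎
      where open ≡-Reasoning

    β0 : β 0F ≡ 0F
    β0 = translation-commuting-with-π (β 0F)
      (trans (sym (β-commutes-with-π 0F)) (β-translation 2F))
      (trans (cong (π ⟨$⟩ʳ_) (sym (β-translation 1F))) (trans (sym (β-commutes-with-π 1F)) (β-translation 3F)))

    β-id : ∀ c → β c ≡ c
    β-id c = trans (β-translation c) (trans (cong (c ⊕_) β0) (⊕-identityʳ c))

    trivial : ∀ x → S x ≡ x
    trivial = trivial-if-fixes-row-zero λ c →
      ≡-by-coordinates (trans (row-zero-S (cell 0F c) (row-cell 0F c)) (sym (row-cell 0F c)))
        (trans (col-S (cell 0F c)) (β-id (col (cell 0F c))))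

  isBase : IsBase partitions
  isBase = Stabilized.trivial

-- Bases found by computation

∀-vector? : ∀ {k} m {P : Vec (Fin k) m → Set} → (∀ v → Dec (P v)) → Dec (∀ v → P v)
∀-vector? zero    P? = map′ (λ p → λ { Vec.[] → p }) (λ ∀P → ∀P Vec.[]) (P? Vec.[])
∀-vector? (suc m) P? = map′ (λ ∀P → λ { (i Vec.∷ v) → ∀P i v }) (λ ∀P i v → ∀P (i Vec.∷ v))
  (all? λ i → ∀-vector? m (λ v → P? (i Vec.∷ v)))

permutations-of-3 : Vec (Vec (Fin 3) 3) 6
permutations-of-3 =
  (0F Vec.∷ 1F Vec.∷ 2F Vec.∷ Vec.[]) Vec.∷ (0F Vec.∷ 2F Vec.∷ 1F Vec.∷ Vec.[]) Vec.∷
  (1F Vec.∷ 0F Vec.∷ 2F Vec.∷ Vec.[]) Vec.∷ (1F Vec.∷ 2F Vec.∷ 0F Vec.∷ Vec.[]) Vec.∷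
  (2F Vec.∷ 0F Vec.∷ 1F Vec.∷ Vec.[]) Vec.∷ (2F Vec.∷ 1F Vec.∷ 0F Vec.∷ Vec.[]) Vec.∷ Vec.[]

applyPermutation : Fin 6 → Fin 3 → Fin 3
applyPermutation p = lookup (lookup permutations-of-3 p)

applyPermutation-zero : ∀ c → applyPermutation 0F c ≡ c
applyPermutation-zero 0F = refl
applyPermutation-zero 1F = refl
applyPermutation-zero 2F = refl

injective-is-listed : (f : Fin 3 → Fin 3) → (∀ {i j} → f i ≡ f j → i ≡ j) → ∃ λ p → ∀ c → f c ≡ applyPermutation p c
injective-is-listed f f-injective = p , agrees
  where
  listed : ∀ u v w → u ≢ v → u ≢ w → v ≢ w →
    ∃ λ p → applyPermutation p 0F ≡ u × applyPermutation p 1F ≡ v × applyPermutation p 2F ≡ w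
  listed = from-yes (all? λ u → all? λ v → all? λ w →
    ¬? (u ≟ v) →-dec ¬? (u ≟ w) →-dec ¬? (v ≟ w) →-dec
    any? λ p → (applyPermutation p 0F ≟ u) ×-dec (applyPermutation p 1F ≟ v) ×-dec (applyPermutation p 2F ≟ w))

  distinct : ∀ {i j} → i ≢ j → f i ≢ f j
  distinct i≢j eq = i≢j (f-injective eq)

  found = listed (f 0F) (f 1F) (f 2F) (distinct λ ()) (distinct λ ()) (distinct λ ())
  p = proj₁ found

  agrees : ∀ c → f c ≡ applyPermutation p c
  agrees 0F = sym (proj₁ (proj₂ found))
  agrees 1F = sym (proj₁ (proj₂ (proj₂ found)))
  agrees 2F = sym (proj₂ (proj₂ (proj₂ found)))

module Tabulated (m a : ℕ) (labels : Vec (Vec (Fin 3) (suc a * 3)) m)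
                 (balanced : ∀ k i → fiberSize (lookup (lookup labels k)) i ≡ suc a) where

  label : Fin m → Fin (suc a * 3) → Fin 3
  label k = lookup (lookup labels k)

  partition : Fin m → Partition (suc a) 3
  partition k = label k , balanced k

  partitions : List (Partition (suc a) 3)
  partitions = tabulate partition

  Realizable : Vec (Fin 6) m → Set
  Realizable ps = ∀ x → ∃ λ y → ∀ k → label k y ≡ applyPermutation (lookup ps k) (label k x)

  Separating : Set
  Separating = ∀ x y → (∀ k → label k x ≡ label k y) → x ≡ y

  separating? : Dec Separating
  separating? = all? λ x → all? λ y → (all? λ k → label k x ≟ label k y) →-dec (x ≟ y)

  OnlyIdentityRealizable : Set
  OnlyIdentityRealizable = ∀ ps → Realizable ps → ∀ k → lookup ps k ≡ 0F

  only-identity-realizable? : Dec OnlyIdentityRealizable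
  only-identity-realizable? = ∀-vector? m λ ps →
    (all? λ x → any? λ y → all? λ k → label k y ≟ applyPermutation (lookup ps k) (label k x))
    →-dec all? λ k → lookup ps k ≟ 0F

  isBase : Separating → OnlyIdentityRealizable → IsBase partitions
  isBase separating only-identity σ fixes x = separating (σ ⟨$⟩ʳ x) x λ k → begin
    label k (σ ⟨$⟩ʳ x)                             ≡⟨ On.α-law k x ⟩
    On.α k (label k x)                             ≡⟨ agrees k (label k x) ⟩
    applyPermutation (lookup ps k) (label k x)     ≡⟨ cong (λ p → applyPermutation p (label k x)) (only-identity ps realizable k) ⟩
    applyPermutation 0F (label k x)                ≡⟨ applyPermutation-zero (label k x) ⟩
    label k x                                      ∎
    where
    open ≡-Reasoning
    module On (k : Fin m) = InducedPermutation σ (partition k) (fixes (partition k) (∈-tabulate⁺ {f = partition} k))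

    induced : ∀ k → ∃ λ p → ∀ c → On.α k c ≡ applyPermutation p c
    induced k = injective-is-listed (On.α k) (On.α-injective k)

    ps : Vec (Fin 6) m
    ps = Vec.tabulate (λ k → proj₁ (induced k))

    agrees : ∀ k c → On.α k c ≡ applyPermutation (lookup ps k) c
    agrees k c = trans (proj₂ (induced k) c) (cong (λ p → applyPermutation p c) (sym (lookup∘tabulate _ k)))

    realizable : Realizable ps
    realizable x = σ ⟨$⟩ʳ x , λ k → trans (On.α-law k x) (agrees k (label k x))

threeByThree : Vec (Vec (Fin 3) 9) 3
threeByThree =
  (0F Vec.∷ 1F Vec.∷ 2F Vec.∷ 0F Vec.∷ 1F Vec.∷ 2F Vec.∷ 0F Vec.∷ 1F Vec.∷ 2F Vec.∷ Vec.[]) Vec.∷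
  (0F Vec.∷ 1F Vec.∷ 2F Vec.∷ 1F Vec.∷ 2F Vec.∷ 0F Vec.∷ 2F Vec.∷ 0F Vec.∷ 1F Vec.∷ Vec.[]) Vec.∷
  (2F Vec.∷ 0F Vec.∷ 2F Vec.∷ 1F Vec.∷ 1F Vec.∷ 0F Vec.∷ 1F Vec.∷ 0F Vec.∷ 2F Vec.∷ Vec.[]) Vec.∷ Vec.[]

module ThreeByThree = Tabulated 3 2 threeByThree
  (from-yes (all? λ k → all? λ i → fiberSize (lookup (lookup threeByThree k)) i ≟ℕ 3))

threeByThree-isBase : IsBase ThreeByThree.partitions
threeByThree-isBase = ThreeByThree.isBase (from-yes ThreeByThree.separating?) (from-yes ThreeByThree.only-identity-realizable?)

fourByThree : Vec (Vec (Fin 3) 12) 4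
fourByThree =
  (0F Vec.∷ 1F Vec.∷ 2F Vec.∷ 0F Vec.∷ 1F Vec.∷ 2F Vec.∷ 0F Vec.∷ 1F Vec.∷ 2F Vec.∷ 0F Vec.∷ 1F Vec.∷ 2F Vec.∷ Vec.[]) Vec.∷
  (0F Vec.∷ 1F Vec.∷ 2F Vec.∷ 1F Vec.∷ 2F Vec.∷ 0F Vec.∷ 2F Vec.∷ 0F Vec.∷ 1F Vec.∷ 0F Vec.∷ 1F Vec.∷ 2F Vec.∷ Vec.[]) Vec.∷
  (0F Vec.∷ 1F Vec.∷ 2F Vec.∷ 0F Vec.∷ 1F Vec.∷ 2F Vec.∷ 0F Vec.∷ 1F Vec.∷ 2F Vec.∷ 1F Vec.∷ 2F Vec.∷ 0F Vec.∷ Vec.[]) Vec.∷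
  (1F Vec.∷ 2F Vec.∷ 0F Vec.∷ 1F Vec.∷ 0F Vec.∷ 2F Vec.∷ 0F Vec.∷ 1F Vec.∷ 2F Vec.∷ 0F Vec.∷ 1F Vec.∷ 2F Vec.∷ Vec.[]) Vec.∷ Vec.[]

module FourByThree = Tabulated 4 3 fourByThree
  (from-yes (all? λ k → all? λ i → fiberSize (lookup (lookup fourByThree k)) i ≟ℕ 4))

fourByThree-isBase : IsBase FourByThree.partitions
fourByThree-isBase = FourByThree.isBase (from-yes FourByThree.separating?) (from-yes FourByThree.only-identity-realizable?)

HasBaseOfSize≤ : ℕ → ℕ → ℕ → Set
HasBaseOfSize≤ a b s = ∃ λ (Ps : List (Partition a b)) → length Ps ≤ s × IsBase Ps

base-when-b≡3 : ∀ a ℓ → 1 ≤ ℓ → 3 ≤ a → a ≤ 3 ^ ℓ → HasBaseOfSize≤ a 3 (ℓ + 2)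
base-when-b≡3 0 ℓ _ () _
base-when-b≡3 1 ℓ _ (s≤s ()) _
base-when-b≡3 2 ℓ _ (s≤s (s≤s ())) _
base-when-b≡3 3 ℓ 1≤ℓ _ _ = ThreeByThree.partitions , +-monoˡ-≤ 2 1≤ℓ , threeByThree-isBase
base-when-b≡3 4 1 _ _ (s≤s (s≤s (s≤s ())))
base-when-b≡3 4 (suc (suc ℓ)) _ _ _ = FourByThree.partitions , s≤s (s≤s (m≤n+m 2 ℓ)) , fourByThree-isBase
base-when-b≡3 (suc (suc (suc (suc (suc k))))) ℓ _ _ fits =
  ShiftAndSwap.partitions k ℓ fits , ≤-reflexive (ShiftAndSwap.length-partitions k ℓ fits) , ShiftAndSwap.isBase k ℓ fits

base-when-b≥4 : ∀ a m ℓ → 1 ≤ ℓ → 3 ≤ a → a ≤ (4 + m) ^ ℓ → HasBaseOfSize≤ a (4 + m) (ℓ + 2)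
base-when-b≥4 0 m ℓ _ () _
base-when-b≥4 1 m ℓ _ (s≤s ()) _
base-when-b≥4 2 m ℓ _ (s≤s (s≤s ())) _
base-when-b≥4 3 m ℓ 1≤ℓ _ _ =
  ThreeRows.partitions m , subst (_≤ ℓ + 2) (sym (ThreeRows.length-partitions m)) (+-monoˡ-≤ 2 1≤ℓ) , ThreeRows.isBase m
base-when-b≥4 (suc (suc (suc (suc k)))) m ℓ _ _ fits =
  ShiftAndThreeCycle.partitions k m ℓ fits , ≤-reflexive (ShiftAndThreeCycle.length-partitions k m ℓ fits) ,
  ShiftAndThreeCycle.isBase k m ℓ fits

corollary4p3 : (a b ℓ : ℕ) → 3 ≤ b → 1 ≤ ℓ → 3 ≤ a → a ≤ b ^ ℓ →
    ∃ (λ (Ps : List (Partition a b)) → length Ps ≤ ℓ + 2 × IsBase Ps)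
corollary4p3 a 0 ℓ () _ _ _
corollary4p3 a 1 ℓ (s≤s ()) _ _ _
corollary4p3 a 2 ℓ (s≤s (s≤s ())) _ _ _
corollary4p3 a 3 ℓ _ 1≤ℓ 3≤a a≤bˡ = base-when-b≡3 a ℓ 1≤ℓ 3≤a a≤bˡ
corollary4p3 a (suc (suc (suc (suc m)))) ℓ _ 1≤ℓ 3≤a a≤bˡ = base-when-b≥4 a m ℓ 1≤ℓ 3≤a a≤bˡ
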